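{- The trace of a well-identified process contains any identifier at most once, and if a transition in the trace has identifier \(i_1 \oplus i_2 \in \mathcal{I}_p\), then neither \(i_1\) nor \(i_2\) occur in the trace.
   Context: Fix an identifier structure: an infinite set \(\mathcal{I}\) of identifiers partitioned into infinite sets of atomic identifiers \(\mathcal{I}_a\) and paired identifiers \(\mathcal{I}_p\), a bijection \(\gamma:\mathbb{N}\to\mathcal{I}_a\) (generator) and a bijection \(\oplus:\mathcal{I}_a\times\mathcal{I}_a\to\mathcal{I}_p\) (pairing). An identifier pattern is a pair \((c,s)\) of integers with \(s>0\); it generates the stream \(\gamma(c),\gamma(c+s),\gamma(c+2s),\dots\). Two patterns are compatible if their streams share no identifier. A splitter \(\cap\) maps a pattern to a pair of compatible patterns, with projections \(\cap_1,\cap_2\). A seed is either a pattern or a pair of seeds whose patterns are all pairwise compatible; \([\cap_j]\) applies \(\cap_j\) to every pattern in a seed. CCS processes are built from prefix \(\lambda.P\), parallel composition \(P\mid Q\), restriction \(P\backslash\lambda\), non-deterministic choice (summation) \(P \veebar Q\), guarded sum \((\lambda_1.P_1)+(\lambda_2.P_2)\), and internal choice \(P\sqcap Q\), over labels consisting of names, co-names, \(\tau\) and \(\upsilon\). An identified process \(\mathsf{s}\circ P\) attaches a seed \(\mathsf{s}\) to \(P\); it is well-identified if \(\mathsf{s}=(\mathsf{s}_1,\mathsf{s}_2)\), \(P=P_1\mid P_2\) with both \(\mathsf{s}_j\circ P_j\) well-identified, or \(P\) is not a parallel composition and \(\mathsf{s}\) is a pattern. The identified labeled transition system (ILTS) is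 CCS's LTS where each transition is also labelled by an identifier: a prefix, guarded-sum or internal-choice step from \((c,s)\circ\cdots\) uses identifier \(\gamma(c)\) and continues with pattern \((c+s,s)\) (split by \(\cap\) across any exposed parallel threads); parallel rules require the two seeds to be compatible and let each thread draw from its own seed; a synchronisation of transitions with identifiers \(i_1,i_2\) gets identifier \(i_1\oplus i_2\); restriction and the choice \(\veebar\) pass identifiers through. A trace is a sequence of composable transitions. -}

module Defs where

open import Data.Nat using (ℕ; _+_; _*_; _<_)
open import Data.Product using (_×_; _,_; proj₁; proj₂; ∃)
open import Data.Sum using (_⊎_; inj₁; inj₂)
open import Data.Unit using (⊤)
open import Data.Empty using (⊥)
open import Data.List using (List; []; _∷_; _++_)
open import Data.List.Membership.Propositional using (_∈_)
open import Relation.Binary.PropositionalEquality using (_≡_; _≢_)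
open import Function.Bundles using (_⤖_; Bijection)

-- Identifier structure
-- I = I_a ⊎ I_p (a partition of I into atomic and paired identifiers),
-- generator γ : ℕ → I_a a bijection, pairing ⊕ : I_a × I_a → I_p a bijection.
-- (Infiniteness of I_a and I_p follows from these bijections.)

record IdStructure : Set₁ where
  field
    Ia      : Set
    Ip      : Set
    gen     : ℕ ⤖ Ia
    pairing : (Ia × Ia) ⤖ Ip

  Id : Set
  Id = Ia ⊎ Ip

  γ : ℕ → Ia
  γ = Bijection.to gen

  _⊕_ : Ia → Ia → Ip
  a ⊕ b = Bijection.to pairing (a , b)

-- Identifier patterns (c , s) with s > 0; stream γ(c), γ(c+s), γ(c+2s), …

record Pattern : Set where
  constructor pat
  field
    start : ℕ
    step  : ℕ
    step>0 : 0 < step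

open Pattern public

nth : Pattern → ℕ → ℕ
nth p k = start p + k * step p

next : Pattern → Pattern
next (pat c s s>0) = pat (c + s) s s>0

module _ (𝕀 : IdStructure) where
  open IdStructure 𝕀

  Compatible : Pattern → Pattern → Set
  Compatible p q = ∀ k₁ k₂ → γ (nth p k₁) ≢ γ (nth q k₂)

  SubStream : Pattern → Pattern → Set
  SubStream p q = ∀ k → ∃ λ k′ → γ (nth p k) ≡ γ (nth q k′)

record Splitter (𝕀 : IdStructure) : Set where
  field
    split   : Pattern → Pattern × Pattern
    compat  : ∀ p → Compatible 𝕀 (proj₁ (split p)) (proj₂ (split p))
    sub₁    : ∀ p → SubStream 𝕀 (proj₁ (split p)) p
    sub₂    : ∀ p → SubStream 𝕀 (proj₂ (split p)) p

  ∩₁ : Pattern → Pattern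
  ∩₁ p = proj₁ (split p)

  ∩₂ : Pattern → Pattern
  ∩₂ p = proj₂ (split p)

-- Seeds (raw trees of patterns; validity is the predicate IsSeed)

data Seed : Set where
  ⟪_⟫  : Pattern → Seed
  _,ₛ_ : Seed → Seed → Seed

patterns : Seed → List Pattern
patterns ⟪ p ⟫ = p ∷ []
patterns (s₁ ,ₛ s₂) = patterns s₁ ++ patterns s₂

module _ (𝕀 : IdStructure) where

  SeedCompatible : Seed → Seed → Set
  SeedCompatible s₁ s₂ =
    ∀ {p q} → p ∈ patterns s₁ → q ∈ patterns s₂ → Compatible 𝕀 p q

  IsSeed : Seed → Set
  IsSeed ⟪ p ⟫ = ⊤
  IsSeed (s₁ ,ₛ s₂) = IsSeed s₁ × IsSeed s₂ × SeedCompatible s₁ s₂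

Name : Set
Name = ℕ

data Label : Set where
  nm : Name → Label
  co : Name → Label
  τ  : Label
  υ  : Label

bar : Label → Label
bar (nm a) = co a
bar (co a) = nm a
bar τ = τ
bar υ = υ

data Visible : Label → Set where
  vis-nm : ∀ a → Visible (nm a)
  vis-co : ∀ a → Visible (co a)

infixr 5 _∣_
data Proc : Set where
  𝟘     : Proc
  _∙_   : Label → Proc → Proc
  _∣_   : Proc → Proc → Proc
  _∖_   : Proc → Name → Proc
  _⊻_   : Proc → Proc → Proc
  gsum  : Label → Proc → Label → Proc → Proc  -- guarded sum (λ₁.P₁)+(λ₂.P₂) = gsum λ₁ P₁ λ₂ P₂
  _⊓_   : Proc → Proc → Proc

WellIdentified : Seed → Proc → Set
WellIdentified (s₁ ,ₛ s₂) (P₁ ∣ P₂) = WellIdentified s₁ P₁ × WellIdentified s₂ P₂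
WellIdentified (s₁ ,ₛ s₂) _ = ⊥
WellIdentified ⟪ p ⟫ (P₁ ∣ P₂) = ⊥
WellIdentified ⟪ p ⟫ _ = ⊤

module ILTS (𝕀 : IdStructure) (sp : Splitter 𝕀) where
  open IdStructure 𝕀 public
  open Splitter sp public

  distribute : Pattern → Proc → Seed
  distribute p (P ∣ Q) = distribute (∩₁ p) P ,ₛ distribute (∩₂ p) Q
  distribute p _ = ⟪ p ⟫

  -- s ∘ P —[ i : α ]→ s′ ∘ P′
  data Step : Seed → Proc → Id → Label → Seed → Proc → Set where
    act  : ∀ {p α P} →
           Step ⟪ p ⟫ (α ∙ P) (inj₁ (γ (start p))) α (distribute (next p) P) P
    sumˡ : ∀ {p α₁ P₁ α₂ P₂} →
           Step ⟪ p ⟫ (gsum α₁ P₁ α₂ P₂) (inj₁ (γ (start p))) α₁ (distribute (next p) P₁) P₁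
    sumʳ : ∀ {p α₁ P₁ α₂ P₂} →
           Step ⟪ p ⟫ (gsum α₁ P₁ α₂ P₂) (inj₁ (γ (start p))) α₂ (distribute (next p) P₂) P₂
    intˡ : ∀ {p P Q} →
           Step ⟪ p ⟫ (P ⊓ Q) (inj₁ (γ (start p))) τ (distribute (next p) P) P
    intʳ : ∀ {p P Q} →
           Step ⟪ p ⟫ (P ⊓ Q) (inj₁ (γ (start p))) τ (distribute (next p) Q) Q
    parˡ : ∀ {s₁ s₂ P₁ P₂ i α s₁′ P₁′} →
           Step s₁ P₁ i α s₁′ P₁′ → SeedCompatible 𝕀 s₁ s₂ →
           Step (s₁ ,ₛ s₂) (P₁ ∣ P₂) i α (s₁′ ,ₛ s₂) (P₁′ ∣ P₂)
    parʳ : ∀ {s₁ s₂ P₁ P₂ i α s₂′ P₂′} →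
           Step s₂ P₂ i α s₂′ P₂′ → SeedCompatible 𝕀 s₁ s₂ →
           Step (s₁ ,ₛ s₂) (P₁ ∣ P₂) i α (s₁ ,ₛ s₂′) (P₁ ∣ P₂′)
    syn  : ∀ {s₁ s₂ P₁ P₂ a₁ a₂ α s₁′ P₁′ s₂′ P₂′} →
           Visible α →
           Step s₁ P₁ (inj₁ a₁) α s₁′ P₁′ →
           Step s₂ P₂ (inj₁ a₂) (bar α) s₂′ P₂′ →
           SeedCompatible 𝕀 s₁ s₂ →
           Step (s₁ ,ₛ s₂) (P₁ ∣ P₂) (inj₂ (a₁ ⊕ a₂)) τ (s₁′ ,ₛ s₂′) (P₁′ ∣ P₂′)
    -- a pattern attached to a parallel composition (e.g. under a restriction
    -- or a choice) is split by ∩ across its exposed parallel threads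
    spl  : ∀ {p P₁ P₂ i α s′ P′} →
           Step (distribute p (P₁ ∣ P₂)) (P₁ ∣ P₂) i α s′ P′ →
           Step ⟪ p ⟫ (P₁ ∣ P₂) i α s′ P′
    res  : ∀ {s P a i α s′ P′} →
           Step s P i α s′ P′ → α ≢ nm a → α ≢ co a →
           Step s (P ∖ a) i α s′ (P′ ∖ a)
    chˡ  : ∀ {s P Q i α s′ P′} →
           Step s P i α s′ P′ → Step s (P ⊻ Q) i α s′ P′
    chʳ  : ∀ {s P Q i α s′ Q′} →
           Step s Q i α s′ Q′ → Step s (P ⊻ Q) i α s′ Q′

  data Trace : Seed → Proc → Set where
    done : ∀ {s P} → Trace s P
    _▹_  : ∀ {s P i α s′ P′} → Step s P i α s′ P′ → Trace s′ P′ → Trace s P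

  ids : ∀ {s P} → Trace s P → List Id
  ids done = []
  ids (_▹_ {i = i} _ t) = i ∷ ids t

-- Every transition draws its identifier from the seed it fires from, and the
-- seed left behind for the rest of the trace is contained in the old one but
-- no longer contains the atomic identifiers just used: the streams only move
-- forward, and the splitter and the parallel rules only ever combine
-- compatible, hence disjoint, streams.  So the atoms of the identifiers along a
-- trace are pairwise disjoint, which gives both claims at once.
module Submission where

open import Defs
open import Data.Product using (_×_; _,_; proj₁; proj₂; ∃)
open import Data.Sum using (_⊎_; inj₁; inj₂; [_,_])
open import Data.Empty using (⊥-elim)
open import Data.Nat using (suc; _*_)
open import Data.Nat.Properties using (+-assoc; +-identityʳ; m+1+n≢m)
open import Data.List using (List; []; _∷_; _++_)
open import Data.List.Properties using (++-identityʳ)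
open import Data.List.Relation.Unary.All as All using (All; []; _∷_)
open import Data.List.Relation.Unary.All.Properties using (++⁺)
open import Data.List.Relation.Unary.Any using (Any; here; there)
import Data.List.Relation.Unary.Any.Properties as Any
open import Data.List.Relation.Unary.AllPairs as AllPairs using (AllPairs; []; _∷_)
open import Data.List.Relation.Unary.Unique.Propositional using (Unique)
open import Data.List.Membership.Propositional using (_∈_; _∉_; find)
open import Data.List.Relation.Binary.Disjoint.Propositional using (Disjoint)
open import Relation.Binary.Core using (Rel)
open import Relation.Binary.PropositionalEquality
  using (_≡_; _≢_; refl; sym; trans; cong; subst)
open import Relation.Nullary using (¬_)
open import Function using (_∘_; Inverse)
open import Function.Bundles using (Bijection)
open import Function.Properties.Bijection using (⤖⇒↔)

AllPairs-∈ : ∀ {a r} {A : Set a} {R : Rel A r} {xs : List A} {x y : A} →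
             AllPairs R xs → x ∈ xs → y ∈ xs → x ≢ y → R x y ⊎ R y x
AllPairs-∈ (_ ∷ _)     (here refl) (here refl) x≢y = ⊥-elim (x≢y refl)
AllPairs-∈ (Rx ∷ _)    (here refl) (there y∈)  _   = inj₁ (All.lookup Rx y∈)
AllPairs-∈ (Rx ∷ _)    (there x∈)  (here refl) _   = inj₂ (All.lookup Rx x∈)
AllPairs-∈ (_ ∷ pairs) (there x∈)  (there y∈)  x≢y = AllPairs-∈ pairs x∈ y∈ x≢y

All¬-All⇒Disjoint : ∀ {a p} {A : Set a} {P : A → Set p} {xs ys : List A} →
                    All (¬_ ∘ P) xs → All P ys → Disjoint xs ys
All¬-All⇒Disjoint ¬Pxs Pys (v∈xs , v∈ys) = All.lookup ¬Pxs v∈xs (All.lookup Pys v∈ys)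

module _ (𝕀 : IdStructure) where
  open IdStructure 𝕀

  infix 4 _∈ₚ_ _∈ₛ_ _∉ₛ_ _⊆ₛ_

  _∈ₚ_ : Ia → Pattern → Set
  a ∈ₚ p = ∃ λ k → a ≡ γ (nth p k)

  _∈ₛ_ : Ia → Seed → Set
  a ∈ₛ ⟪ p ⟫     = a ∈ₚ p
  a ∈ₛ (s₁ ,ₛ s₂) = a ∈ₛ s₁ ⊎ a ∈ₛ s₂

  _∉ₛ_ : Ia → Seed → Set
  a ∉ₛ s = ¬ a ∈ₛ s

  _⊆ₛ_ : Seed → Seed → Set
  s ⊆ₛ s′ = ∀ {a} → a ∈ₛ s → a ∈ₛ s′

  start∈ₚ : ∀ p → γ (start p) ∈ₚ p
  start∈ₚ p = 0 , cong γ (sym (+-identityʳ (start p)))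

  nth-next : ∀ p k → nth (next p) k ≡ nth p (suc k)
  nth-next (pat c s _) k = +-assoc c s (k * s)

  next⊆ₚ : ∀ {a} p → a ∈ₚ next p → a ∈ₚ p
  next⊆ₚ p (k , a≡) = suc k , trans a≡ (cong γ (nth-next p k))

  start∉next : ∀ p → ¬ γ (start p) ∈ₚ next p
  start∉next p@(pat c (suc s) _) (k , eq) =
    m+1+n≢m c (sym (Bijection.injective gen (trans eq (cong γ (nth-next p k)))))

  ∈ₛ⇒∈patterns : ∀ {a} s → a ∈ₛ s → Any (a ∈ₚ_) (patterns s)
  ∈ₛ⇒∈patterns ⟪ p ⟫      a∈        = here a∈
  ∈ₛ⇒∈patterns (s₁ ,ₛ s₂) (inj₁ a∈) = Any.++⁺ˡ (∈ₛ⇒∈patterns s₁ a∈)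
  ∈ₛ⇒∈patterns (s₁ ,ₛ s₂) (inj₂ a∈) = Any.++⁺ʳ (patterns s₁) (∈ₛ⇒∈patterns s₂ a∈)

  compatible⇒disjoint : ∀ {s₁ s₂ a} → SeedCompatible 𝕀 s₁ s₂ → a ∈ₛ s₁ → a ∉ₛ s₂
  compatible⇒disjoint {s₁} {s₂} compat a∈₁ a∈₂
    with find (∈ₛ⇒∈patterns s₁ a∈₁) | find (∈ₛ⇒∈patterns s₂ a∈₂)
  ... | _ , p∈ , k₁ , a≡₁ | _ , q∈ , k₂ , a≡₂ = compat p∈ q∈ k₁ k₂ (trans (sym a≡₁) a≡₂)

  compatible⇒disjointʳ : ∀ {s₁ s₂ a} → SeedCompatible 𝕀 s₁ s₂ → a ∈ₛ s₂ → a ∉ₛ s₁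
  compatible⇒disjointʳ compat a∈₂ a∈₁ = compatible⇒disjoint compat a∈₁ a∈₂

  unpair : Ip → Ia × Ia
  unpair = Inverse.from (⤖⇒↔ pairing)

  atoms : Id → List Ia
  atoms (inj₁ a) = a ∷ []
  atoms (inj₂ x) = proj₁ (unpair x) ∷ proj₂ (unpair x) ∷ []

  atoms-⊕ : ∀ a₁ a₂ → atoms (inj₂ (a₁ ⊕ a₂)) ≡ a₁ ∷ a₂ ∷ []
  atoms-⊕ a₁ a₂ rewrite Inverse.strictlyInverseʳ (⤖⇒↔ pairing) (a₁ , a₂) = refl

  ∈-atoms-⊕ˡ : ∀ a₁ a₂ → a₁ ∈ atoms (inj₂ (a₁ ⊕ a₂))
  ∈-atoms-⊕ˡ a₁ a₂ rewrite atoms-⊕ a₁ a₂ = here refl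

  ∈-atoms-⊕ʳ : ∀ a₁ a₂ → a₂ ∈ atoms (inj₂ (a₁ ⊕ a₂))
  ∈-atoms-⊕ʳ a₁ a₂ rewrite atoms-⊕ a₁ a₂ = there (here refl)

  AtomsDisjoint : Id → Id → Set
  AtomsDisjoint i j = Disjoint (atoms i) (atoms j)

  AtomsDisjoint⇒≢ : ∀ {i j} → AtomsDisjoint i j → i ≢ j
  AtomsDisjoint⇒≢ {inj₁ _} disjoint refl = disjoint (here refl , here refl)
  AtomsDisjoint⇒≢ {inj₂ _} disjoint refl = disjoint (here refl , here refl)

  pair∈⇒atom∉ : ∀ {is x a} → AllPairs AtomsDisjoint is →
                inj₂ x ∈ is → a ∈ atoms (inj₂ x) → inj₁ a ∉ is
  pair∈⇒atom∉ pairs x∈ a∈x a∈ with AllPairs-∈ pairs x∈ a∈ (λ ())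
  ... | inj₁ disjoint = disjoint (a∈x , here refl)
  ... | inj₂ disjoint = disjoint (here refl , a∈x)

  record Consumes (s : Seed) (as : List Ia) (s′ : Seed) : Set where
    field
      drawn   : All (_∈ₛ s) as
      shrinks : s′ ⊆ₛ s
      spent   : All (_∉ₛ s′) as
  open Consumes

  consumes-nothing : ∀ {s} → Consumes s [] s
  consumes-nothing = record { drawn = [] ; shrinks = λ a∈ → a∈ ; spent = [] }

  consumes-widen : ∀ {s₀ s as s′} → s ⊆ₛ s₀ → Consumes s as s′ → Consumes s₀ as s′
  consumes-widen s⊆s₀ c = record
    { drawn = All.map s⊆s₀ (drawn c) ; shrinks = s⊆s₀ ∘ shrinks c ; spent = spent c }

  consumes-∥ : ∀ {s₁ s₂ as bs s₁′ s₂′} → SeedCompatible 𝕀 s₁ s₂ →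
               Consumes s₁ as s₁′ → Consumes s₂ bs s₂′ →
               Consumes (s₁ ,ₛ s₂) (as ++ bs) (s₁′ ,ₛ s₂′)
  consumes-∥ compat c₁ c₂ = record
    { drawn   = ++⁺ (All.map inj₁ (drawn c₁)) (All.map inj₂ (drawn c₂))
    ; shrinks = [ inj₁ ∘ shrinks c₁ , inj₂ ∘ shrinks c₂ ]
    ; spent   = ++⁺
        (All.zipWith (λ (a∉₁′ , a∈₁) →
           [ a∉₁′ , compatible⇒disjoint compat a∈₁ ∘ shrinks c₂ ]) (spent c₁ , drawn c₁))
        (All.zipWith (λ (a∉₂′ , a∈₂) →
           [ compatible⇒disjointʳ compat a∈₂ ∘ shrinks c₁ , a∉₂′ ]) (spent c₂ , drawn c₂))
    }

  module _ (sp : Splitter 𝕀) where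
    open ILTS 𝕀 sp using (distribute; Step; Trace; ids; ∩₁; ∩₂; sub₁; sub₂)
    open Step
    open Trace

    distribute⊆ : ∀ p P → distribute p P ⊆ₛ ⟪ p ⟫
    distribute⊆ p 𝟘              a∈ = a∈
    distribute⊆ p (_ ∙ _)        a∈ = a∈
    distribute⊆ p (_ ∖ _)        a∈ = a∈
    distribute⊆ p (_ ⊻ _)        a∈ = a∈
    distribute⊆ p (gsum _ _ _ _) a∈ = a∈
    distribute⊆ p (_ ⊓ _)        a∈ = a∈
    distribute⊆ p (P ∣ Q) (inj₁ a∈) with distribute⊆ (∩₁ p) P a∈
    ... | k , a≡ = let k′ , ≡γ = sub₁ p k in k′ , trans a≡ ≡γ
    distribute⊆ p (P ∣ Q) (inj₂ a∈) with distribute⊆ (∩₂ p) Q a∈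
    ... | k , a≡ = let k′ , ≡γ = sub₂ p k in k′ , trans a≡ ≡γ

    consumes-start : ∀ p P → Consumes ⟪ p ⟫ (γ (start p) ∷ []) (distribute (next p) P)
    consumes-start p P = record
      { drawn   = start∈ₚ p ∷ []
      ; shrinks = next⊆ₚ p ∘ distribute⊆ (next p) P
      ; spent   = start∉next p ∘ distribute⊆ (next p) P ∷ []
      }

    step-consumes : ∀ {s P i α s′ P′} → Step s P i α s′ P′ → Consumes s (atoms i) s′
    step-consumes (act  {p} {P = P})   = consumes-start p P
    step-consumes (sumˡ {p} {P₁ = P₁}) = consumes-start p P₁
    step-consumes (sumʳ {p} {P₂ = P₂}) = consumes-start p P₂
    step-consumes (intˡ {p} {P})       = consumes-start p P
    step-consumes (intʳ {p} {Q = Q})   = consumes-start p Q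
    step-consumes (parˡ {i = i} st compat) =
      subst (λ as → Consumes _ as _) (++-identityʳ (atoms i))
            (consumes-∥ compat (step-consumes st) consumes-nothing)
    step-consumes (parʳ st compat) = consumes-∥ compat consumes-nothing (step-consumes st)
    step-consumes (syn {a₁ = a₁} {a₂ = a₂} _ st₁ st₂ compat) rewrite atoms-⊕ a₁ a₂ =
      consumes-∥ compat (step-consumes st₁) (step-consumes st₂)
    step-consumes (spl {p} {P₁} {P₂} st) =
      consumes-widen (distribute⊆ p (P₁ ∣ P₂)) (step-consumes st)
    step-consumes (res st _ _) = step-consumes st
    step-consumes (chˡ st)     = step-consumes st
    step-consumes (chʳ st)     = step-consumes st

    trace-atoms : ∀ {s P} (t : Trace s P) →
                  All (All (_∈ₛ s) ∘ atoms) (ids t) × AllPairs AtomsDisjoint (ids t)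
    trace-atoms done = [] , []
    trace-atoms (st ▹ t) =
      drawn c ∷ All.map (All.map (shrinks c)) later ,
      All.map (All¬-All⇒Disjoint (spent c)) later ∷ disjoint
      where
      c = step-consumes st
      later    = proj₁ (trace-atoms t)
      disjoint = proj₂ (trace-atoms t)

lemma1 : (𝕀 : IdStructure) (sp : Splitter 𝕀) →
         let open ILTS 𝕀 sp in
         ∀ {s : Seed} {P : Proc} →
         IsSeed 𝕀 s → WellIdentified s P →
         (t : Trace s P) →
         Unique (ids t) ×
         (∀ a₁ a₂ → inj₂ (a₁ ⊕ a₂) ∈ ids t →
            inj₁ a₁ ∉ ids t × inj₁ a₂ ∉ ids t)
lemma1 𝕀 sp _ _ t =
  AllPairs.map (AtomsDisjoint⇒≢ 𝕀) disjoint ,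
  λ a₁ a₂ x∈ → pair∈⇒atom∉ 𝕀 disjoint x∈ (∈-atoms-⊕ˡ 𝕀 a₁ a₂) ,
               pair∈⇒atom∉ 𝕀 disjoint x∈ (∈-atoms-⊕ʳ 𝕀 a₁ a₂)
  where disjoint = proj₂ (trace-atoms 𝕀 sp t)
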